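{- Let $a, b$ be nonzero integers such that $-ab$ is not a perfect square, let $\varepsilon \in \{1, -1\}$, and let $X, Y \in M_2(\mathbb{Z})$. Then $aX^2 + bY^2 = \varepsilon I$ and $XY = YX$ if and only if one of the following holds: (i) $X = t_1 I$ and $Y = t_2 I$, where $t_1, t_2 \in \mathbb{Z}$ satisfy $a t_1^2 + b t_2^2 = \varepsilon$; (ii) $X = t_1 I$ and $Y = \begin{pmatrix} t_4 & t_2 \\ t_3 & -t_4 \end{pmatrix}$, where $t_1, t_2, t_3, t_4 \in \mathbb{Z}$ satisfy $a t_1^2 + b(t_4^2 + t_2 t_3) = \varepsilon$; (iii) $X = \begin{pmatrix} t_1 & \frac{u-\varepsilon}{g} t_2 \\ \frac{u-\varepsilon}{g} t_3 & \varepsilon(u t_1 + vb t_4) \end{pmatrix}$ and $Y = \begin{pmatrix} t_4 & \frac{va}{g} t_2 \\ \frac{va}{g} t_3 & \varepsilon(va t_1 - u t_4) \end{pmatrix}$, where $t_1, t_2, t_3, t_4, u, v \in \mathbb{Z}$, $u \neq \varepsilon$, $g = \gcd(va, u - \varepsilon)$, and $$u^2 + v^2 ab = 1, \qquad a t_1^2 + b t_4^2 + \frac{2a\, t_2 t_3}{g^2}(1 - \varepsilon u) = \varepsilon.$$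
   Context: $M_2(\mathbb{Z})$ denotes the ring of $2\times 2$ matrices with integer entries; $I$ is the $2\times 2$ identity matrix. -}

module Defs where

open import Data.Nat using (suc)
open import Data.Integer using (ℤ; +_; -[1+_]; _+_; _*_; -_; 0ℤ; 1ℤ)
import Data.Integer as ℤ
open import Data.Product using (Σ)
open import Relation.Binary.PropositionalEquality using (_≡_)

record M₂ : Set where
  constructor mat
  field
    m11 m12 m21 m22 : ℤ

open M₂ public

_⊞_ : M₂ → M₂ → M₂
mat a b c d ⊞ mat a' b' c' d' = mat (a + a') (b + b') (c + c') (d + d')

_⊠_ : M₂ → M₂ → M₂
mat a b c d ⊠ mat a' b' c' d' =
  mat (a * a' + b * c') (a * b' + b * d') (c * a' + d * c') (c * b' + d * d')

_·_ : ℤ → M₂ → M₂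
k · mat a b c d = mat (k * a) (k * b) (k * c) (k * d)

I : M₂
I = mat 1ℤ 0ℤ 0ℤ 1ℤ

-- integer division, with the (never used) convention  x // 0 = 0;
-- in the statement it is only applied to a nonzero divisor dividing the dividend
_//_ : ℤ → ℤ → ℤ
x // (+ 0) = 0ℤ
x // (+ (suc n)) = x ℤ./ (+ suc n)
x // -[1+ n ] = x ℤ./ -[1+ n ]

IsSquare : ℤ → Set
IsSquare k = Σ ℤ (λ t → t * t ≡ k)

{-# OPTIONS --safe #-}
-- For commuting X, Y with aX² + bY² = εI, multiplying by adj X and using
-- adj X · Y + adj Y · X = v I (the polarisation of det) gives the linear relations
--   ε adj X = u X + v b Y,   ε adj Y = v a X − u Y,
-- where u = a det X − b det Y and v is the mixed determinant of X and Y.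
-- A linear form vanishing on I turns adj into negation, so if X is not scalar and p ≠ 0
-- is such a coordinate of X, with q the same coordinate of Y, then
-- −εp = up + vbq and −εq = vap − uq; eliminating q gives u² + v²ab = 1, and u ≠ ε.
-- The off-diagonal entries then satisfy va·x = (u − ε)·y, so they are multiples of the
-- coprime cofactors (u − ε)/g and va/g, and the (1,1) entry of the equation becomes the
-- stated norm condition. If X is scalar then bY² is scalar, so Y is scalar or traceless.
module Submission where

open import Defs
open import Data.Integer using (ℤ; _+_; _*_; _-_; -_; 0ℤ; 1ℤ; -1ℤ; +_; ∣_∣; NonZero; ≢-nonZero; _/_; _%_; -[1+_])
open import Data.Integer.Properties
open import Data.Integer.Tactic.RingSolver using (solve)
open import Data.Integer.DivMod using (a≡a%n+[a/n]*n; n%d<d)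
open import Data.Integer.GCD using (gcd; gcd[i,j]∣i; gcd[i,j]∣j; gcd[i,j]≡0⇒j≡0)
import Data.Integer.Divisibility.Signed as Signed
import Data.Nat as ℕ
import Data.Nat.Properties as ℕ
import Data.Nat.Divisibility as ℕ
import Data.Nat.GCD as ℕ
open import Algebra.Properties.AbelianGroup +-0-abelianGroup using (∙-cancelʳ; ⁻¹-anti-homo‿-)
open import Data.List using (_∷_; [])
open import Data.Product using (_×_; ∃; ∃-syntax; _,_; proj₁; proj₂; <_,_>)
open import Data.Sum using (_⊎_; inj₁; inj₂)
import Data.Sum as Sum
open import Data.Empty using (⊥-elim)
open import Relation.Binary.PropositionalEquality
open import Relation.Nullary using (¬_; Dec; yes; no)
open import Function.Bundles using (_⇔_; mk⇔)

infixl 6 _⊕_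
infixl 7 _⊙_

_⊙_ : ∀ (c : ℤ) {s t : ℤ} → s ≡ t → c * s ≡ c * t
c ⊙ e = cong (c *_) e

_⊕_ : ∀ {s t s′ t′ : ℤ} → s ≡ t → s′ ≡ t′ → s + s′ ≡ t + t′
_⊕_ = cong₂ _+_

-- L ≡ R follows from a combination Σ cᵢ sᵢ ≡ Σ cᵢ tᵢ of known equations (built with _⊙_ and
-- _⊕_) once L − R = Σ cᵢ (sᵢ − tᵢ) is a ring identity, which is the second argument.
linear-combination : ∀ {L R S T : ℤ} → S ≡ T → L + T ≡ R + S → L ≡ R
linear-combination {L} {R} {S} {T} S≡T identity =
  ∙-cancelʳ T L R (trans identity (cong (_+_ R) S≡T))

*-≢0 : ∀ {i j : ℤ} → i ≢ 0ℤ → j ≢ 0ℤ → i * j ≢ 0ℤ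
*-≢0 {i} i≢0 j≢0 ij≡0 with i*j≡0⇒i≡0∨j≡0 i ij≡0
... | inj₁ i≡0 = i≢0 i≡0
... | inj₂ j≡0 = j≢0 j≡0

*≡0⇒≡0 : ∀ {i j : ℤ} → j ≢ 0ℤ → i * j ≡ 0ℤ → i ≡ 0ℤ
*≡0⇒≡0 {i} j≢0 ij≡0 with i*j≡0⇒i≡0∨j≡0 i ij≡0
... | inj₁ i≡0 = i≡0
... | inj₂ j≡0 = ⊥-elim (j≢0 j≡0)

unit≢0 : ∀ {ε : ℤ} → ε * ε ≡ 1ℤ → ε ≢ 0ℤ
unit≢0 ε² refl with ε²
... | ()

unscale : ∀ ε {z w : ℤ} → ε * ε ≡ 1ℤ → ε * z ≡ w → z ≡ ε * w
unscale ε {z} {w} ε² e =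
  linear-combination (ε ⊙ e ⊕ - z ⊙ ε²) (solve (ε ∷ z ∷ w ∷ []))

/-exact : ∀ x g .{{_ : NonZero g}} → g Signed.∣ x → (x / g) * g ≡ x
/-exact x g g∣x = sym (trans x≡0+[x/g]*g (+-identityˡ ((x / g) * g)))
  where
  g∣rem : g Signed.∣ + (x % g)
  g∣rem = Signed.∣m+n∣n⇒∣m (subst (g Signed.∣_) (a≡a%n+[a/n]*n x g) g∣x)
                           (Signed.∣n⇒∣m*n (x / g) Signed.∣-refl)
  rem≡0 : x % g ≡ 0
  rem≡0 with x % g | n%d<d x g | Signed.∣⇒∣ᵤ g∣rem
  ... | 0 | _ | _ = refl
  ... | ℕ.suc r | r<g | g∣r = ⊥-elim (ℕ.<⇒≱ r<g (ℕ.∣⇒≤ g∣r))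
  x≡0+[x/g]*g : x ≡ + 0 + (x / g) * g
  x≡0+[x/g]*g = subst (λ r → x ≡ + r + (x / g) * g) rem≡0 (a≡a%n+[a/n]*n x g)

//-exact : ∀ x g → g ≢ 0ℤ → g Signed.∣ x → (x // g) * g ≡ x
//-exact x (+ 0) g≢0 _ = ⊥-elim (g≢0 refl)
//-exact x g@(+ ℕ.suc _) _ g∣x = /-exact x g g∣x
//-exact x g@(-[1+ _ ]) _ g∣x = /-exact x g g∣x

-- U divides both V x and U x, hence their gcd ∣x∣ · gcd V U.
cofactor-∣ : ∀ {U V P x y : ℤ} → gcd V U ≢ 0ℤ → P * gcd V U ≡ U → V * x ≡ U * y → P Signed.∣ x
cofactor-∣ {U} {V} {P} {x} {y} g≢0 P*g≡U Vx≡Uy =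
  Signed.∣ᵤ⇒∣ (ℕ.*-cancelʳ-∣ G {{ℕ.≢-nonZero (λ G≡0 → g≢0 (cong +_ G≡0))}} PG∣xG)
  where
  G = ℕ.gcd (∣ V ∣) (∣ U ∣)
  ∣U∣≡∣P∣G : ∣ U ∣ ≡ ∣ P ∣ ℕ.* G
  ∣U∣≡∣P∣G = trans (cong ∣_∣ (sym P*g≡U)) (abs-* P (gcd V U))
  U∣xV : ∣ U ∣ ℕ.∣ ∣ x ∣ ℕ.* ∣ V ∣
  U∣xV = ℕ.divides (∣ y ∣) (begin
    ∣ x ∣ ℕ.* ∣ V ∣   ≡⟨ ℕ.*-comm (∣ x ∣) (∣ V ∣) ⟩
    ∣ V ∣ ℕ.* ∣ x ∣   ≡⟨ abs-* V x ⟨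
    ∣ V * x ∣         ≡⟨ cong ∣_∣ Vx≡Uy ⟩
    ∣ U * y ∣         ≡⟨ abs-* U y ⟩
    ∣ U ∣ ℕ.* ∣ y ∣   ≡⟨ ℕ.*-comm (∣ U ∣) (∣ y ∣) ⟩
    ∣ y ∣ ℕ.* ∣ U ∣   ∎)
    where open ≡-Reasoning
  U∣xG : ∣ U ∣ ℕ.∣ ∣ x ∣ ℕ.* G
  U∣xG = subst (∣ U ∣ ℕ.∣_) (sym (ℕ.c*gcd[m,n]≡gcd[cm,cn] (∣ x ∣) (∣ V ∣) (∣ U ∣)))
               (ℕ.gcd-greatest U∣xV (ℕ.n∣m*n (∣ x ∣)))
  PG∣xG : ∣ P ∣ ℕ.* G ℕ.∣ ∣ x ∣ ℕ.* G
  PG∣xG = subst (ℕ._∣ ∣ x ∣ ℕ.* G) ∣U∣≡∣P∣G U∣xG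

cofactor-cancel : ∀ {U V P Q g x y t : ℤ} → U ≢ 0ℤ → P * g ≡ U → Q * g ≡ V →
  V * x ≡ U * y → x ≡ P * t → y ≡ Q * t
cofactor-cancel {P = P} {Q} {g} {y = y} {t} U≢0 refl refl e refl =
  *-cancelʳ-≡ y (Q * t) (P * g) {{≢-nonZero U≢0}}
    (linear-combination (-1ℤ ⊙ e) (solve (P ∷ Q ∷ g ∷ y ∷ t ∷ [])))

gcd≢0 : ∀ V {U : ℤ} → U ≢ 0ℤ → gcd V U ≢ 0ℤ
gcd≢0 V U≢0 g≡0 = U≢0 (gcd[i,j]≡0⇒j≡0 {V} g≡0)

cofactorˡ-exact : ∀ V U → U ≢ 0ℤ → (V // gcd V U) * gcd V U ≡ V
cofactorˡ-exact V U U≢0 = //-exact V (gcd V U) (gcd≢0 V U≢0) (Signed.∣ᵤ⇒∣ (gcd[i,j]∣i V U))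

cofactorʳ-exact : ∀ V U → U ≢ 0ℤ → (U // gcd V U) * gcd V U ≡ U
cofactorʳ-exact V U U≢0 = //-exact U (gcd V U) (gcd≢0 V U≢0) (Signed.∣ᵤ⇒∣ (gcd[i,j]∣j V U))

cofactor-split : ∀ V {U x y : ℤ} → U ≢ 0ℤ → V * x ≡ U * y →
  ∃[ t ] (x ≡ (U // gcd V U) * t × y ≡ (V // gcd V U) * t)
cofactor-split V {U} {x} {y} U≢0 e =
  t , x≡Pt , cofactor-cancel {P = U // gcd V U} {Q = V // gcd V U} {t = t} U≢0 P*g≡U Q*g≡V e x≡Pt
  where
  P*g≡U = cofactorʳ-exact V U U≢0
  Q*g≡V = cofactorˡ-exact V U U≢0
  P∣x : (U // gcd V U) Signed.∣ x
  P∣x = cofactor-∣ {U} {V} (gcd≢0 V U≢0) P*g≡U e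
  t = Signed._∣_.quotient P∣x
  x≡Pt : x ≡ (U // gcd V U) * t
  x≡Pt = trans (Signed._∣_.equality P∣x) (*-comm t (U // gcd V U))

mat-cong : ∀ {x₁ x₂ x₃ x₄ y₁ y₂ y₃ y₄ : ℤ} → x₁ ≡ y₁ → x₂ ≡ y₂ → x₃ ≡ y₃ → x₄ ≡ y₄ →
  mat x₁ x₂ x₃ x₄ ≡ mat y₁ y₂ y₃ y₄
mat-cong refl refl refl refl = refl

det : M₂ → ℤ
det (mat x₁ x₂ x₃ x₄) = x₁ * x₄ - x₂ * x₃

adj : M₂ → M₂
adj (mat x₁ x₂ x₃ x₄) = mat x₄ (- x₂) (- x₃) x₁

-- det (X ⊞ Y) = det X + det Y + mixedDet X Y
mixedDet : M₂ → M₂ → ℤ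
mixedDet (mat x₁ x₂ x₃ x₄) (mat y₁ y₂ y₃ y₄) = x₁ * y₄ + x₄ * y₁ - x₂ * y₃ - x₃ * y₂

mixedDet-comm : ∀ X Y → mixedDet X Y ≡ mixedDet Y X
mixedDet-comm (mat x₁ x₂ x₃ x₄) (mat y₁ y₂ y₃ y₄) = symmetric
  where
  symmetric : x₁ * y₄ + x₄ * y₁ - x₂ * y₃ - x₃ * y₂ ≡ y₁ * x₄ + y₄ * x₁ - y₂ * x₃ - y₃ * x₂
  symmetric = solve (x₁ ∷ x₂ ∷ x₃ ∷ x₄ ∷ y₁ ∷ y₂ ∷ y₃ ∷ y₄ ∷ [])

⊞-comm : (A B : M₂) → A ⊞ B ≡ B ⊞ A
⊞-comm A B = mat-cong (+-comm (m11 A) (m11 B)) (+-comm (m12 A) (m12 B))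
                      (+-comm (m21 A) (m21 B)) (+-comm (m22 A) (m22 B))

·-assoc : ∀ k l (A : M₂) → k · (l · A) ≡ (k * l) · A
·-assoc k l A = mat-cong (sym (*-assoc k l (m11 A))) (sym (*-assoc k l (m12 A)))
                         (sym (*-assoc k l (m21 A))) (sym (*-assoc k l (m22 A)))

·-distribʳ-⊞ : ∀ k l (A : M₂) → (k · A) ⊞ (l · A) ≡ (k + l) · A
·-distribʳ-⊞ k l A = mat-cong (sym (*-distribʳ-+ (m11 A) k l)) (sym (*-distribʳ-+ (m12 A) k l))
                              (sym (*-distribʳ-+ (m21 A) k l)) (sym (*-distribʳ-+ (m22 A) k l))

scalar-mat : ∀ k → mat k 0ℤ 0ℤ k ≡ k · I
scalar-mat k = mat-cong (sym (*-identityʳ k)) (sym (*-zeroʳ k)) (sym (*-zeroʳ k)) (sym (*-identityʳ k))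

·I-⊠ : ∀ k (A : M₂) → (k · I) ⊠ A ≡ k · A
·I-⊠ k (mat a₁ a₂ a₃ a₄) = trans (cong (_⊠ mat a₁ a₂ a₃ a₄) (sym (scalar-mat k)))
  (mat-cong (solve vars) (solve vars) (solve vars) (solve vars))
  where vars = k ∷ a₁ ∷ a₂ ∷ a₃ ∷ a₄ ∷ []

⊠-·I : ∀ (A : M₂) k → A ⊠ (k · I) ≡ k · A
⊠-·I (mat a₁ a₂ a₃ a₄) k = trans (cong (mat a₁ a₂ a₃ a₄ ⊠_) (sym (scalar-mat k)))
  (mat-cong (solve vars) (solve vars) (solve vars) (solve vars))
  where vars = k ∷ a₁ ∷ a₂ ∷ a₃ ∷ a₄ ∷ []

scalar-commutes : ∀ k (A : M₂) → (k · I) ⊠ A ≡ A ⊠ (k · I)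
scalar-commutes k A = trans (·I-⊠ k A) (sym (⊠-·I A k))

scalar-square : ∀ k → (k · I) ⊠ (k · I) ≡ (k * k) · I
scalar-square k = trans (·I-⊠ k (k · I)) (·-assoc k k I)

traceless-square : ∀ d b c → mat d b c (- d) ⊠ mat d b c (- d) ≡ (d * d + b * c) · I
traceless-square d b c = mat-cong (solve vars) (solve vars) (solve vars) (solve vars)
  where vars = d ∷ b ∷ c ∷ []

scalar-combination : ∀ a b r s → (a · (r · I)) ⊞ (b · (s · I)) ≡ (a * r + b * s) · I
scalar-combination a b r s =
  trans (cong₂ _⊞_ (·-assoc a r I) (·-assoc b s I)) (·-distribʳ-⊞ (a * r) (b * s) I)

record CommutingSolution (a b ε : ℤ) (X Y : M₂) : Set where
  constructor solution
  field
    equation : (a · (X ⊠ X)) ⊞ (b · (Y ⊠ Y)) ≡ ε · I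
    commute  : X ⊠ Y ≡ Y ⊠ X

open CommutingSolution

ScalarPair : ℤ → ℤ → ℤ → M₂ → M₂ → Set
ScalarPair a b ε X Y = ∃[ t₁ ] ∃[ t₂ ] (X ≡ t₁ · I × Y ≡ t₂ · I × a * t₁ * t₁ + b * t₂ * t₂ ≡ ε)

ScalarTracelessPair : ℤ → ℤ → ℤ → M₂ → M₂ → Set
ScalarTracelessPair a b ε X Y = ∃[ t₁ ] ∃[ t₂ ] ∃[ t₃ ] ∃[ t₄ ]
  (X ≡ t₁ · I × Y ≡ mat t₄ t₂ t₃ (- t₄) × a * t₁ * t₁ + b * (t₄ * t₄ + t₂ * t₃) ≡ ε)

CofactorPair : ℤ → ℤ → ℤ → M₂ → M₂ → Set
CofactorPair a b ε X Y = ∃[ t₁ ] ∃[ t₂ ] ∃[ t₃ ] ∃[ t₄ ] ∃[ u ] ∃[ v ]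
  (let g = gcd (v * a) (u - ε) in
   u ≢ ε
   × X ≡ mat t₁ (((u - ε) // g) * t₂) (((u - ε) // g) * t₃) (ε * (u * t₁ + v * b * t₄))
   × Y ≡ mat t₄ (((v * a) // g) * t₂) (((v * a) // g) * t₃) (ε * (v * a * t₁ - u * t₄))
   × u * u + v * v * (a * b) ≡ 1ℤ
   × (a * t₁ * t₁ + b * t₄ * t₄) * (g * g) + (+ 2) * a * t₂ * t₃ * (1ℤ - ε * u) ≡ ε * (g * g))

Listed : ℤ → ℤ → ℤ → M₂ → M₂ → Set
Listed a b ε X Y = ScalarPair a b ε X Y ⊎ ScalarTracelessPair a b ε X Y ⊎ CofactorPair a b ε X Y

record EntryEquations (a b ε x₁ x₂ x₃ x₄ y₁ y₂ y₃ y₄ : ℤ) : Set where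
  field
    square₁₁ : a * (x₁ * x₁ + x₂ * x₃) + b * (y₁ * y₁ + y₂ * y₃) ≡ ε * 1ℤ
    square₁₂ : a * (x₁ * x₂ + x₂ * x₄) + b * (y₁ * y₂ + y₂ * y₄) ≡ ε * 0ℤ
    square₂₁ : a * (x₃ * x₁ + x₄ * x₃) + b * (y₃ * y₁ + y₄ * y₃) ≡ ε * 0ℤ
    square₂₂ : a * (x₃ * x₂ + x₄ * x₄) + b * (y₃ * y₂ + y₄ * y₄) ≡ ε * 1ℤ
    commute₁₁ : x₁ * y₁ + x₂ * y₃ ≡ y₁ * x₁ + y₂ * x₃
    commute₁₂ : x₁ * y₂ + x₂ * y₄ ≡ y₁ * x₂ + y₂ * x₄
    commute₂₁ : x₃ * y₁ + x₄ * y₃ ≡ y₃ * x₁ + y₄ * x₃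
    commute₂₂ : x₃ * y₂ + x₄ * y₄ ≡ y₃ * x₂ + y₄ * x₄

solution⇒entries : ∀ {a b ε x₁ x₂ x₃ x₄ y₁ y₂ y₃ y₄} →
  CommutingSolution a b ε (mat x₁ x₂ x₃ x₄) (mat y₁ y₂ y₃ y₄) → EntryEquations a b ε x₁ x₂ x₃ x₄ y₁ y₂ y₃ y₄
solution⇒entries (solution H C) = record
  { square₁₁ = cong m11 H ; square₁₂ = cong m12 H ; square₂₁ = cong m21 H ; square₂₂ = cong m22 H
  ; commute₁₁ = cong m11 C ; commute₁₂ = cong m12 C ; commute₂₁ = cong m21 C ; commute₂₂ = cong m22 C
  }

entries⇒solution : ∀ {a b ε x₁ x₂ x₃ x₄ y₁ y₂ y₃ y₄} →
  EntryEquations a b ε x₁ x₂ x₃ x₄ y₁ y₂ y₃ y₄ → CommutingSolution a b ε (mat x₁ x₂ x₃ x₄) (mat y₁ y₂ y₃ y₄)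
entries⇒solution E = solution (mat-cong square₁₁ square₁₂ square₂₁ square₂₂)
                              (mat-cong commute₁₁ commute₁₂ commute₂₁ commute₂₂)
  where open EntryEquations E

swap-solution : ∀ {a b ε X Y} → CommutingSolution a b ε X Y → CommutingSolution b a ε Y X
swap-solution {a} {b} {X = X} {Y} (solution H C) =
  solution (trans (⊞-comm (b · (Y ⊠ Y)) (a · (X ⊠ X))) H) (sym C)

adj-relation : ∀ {a b ε} (X Y : M₂) → CommutingSolution a b ε X Y →
  ε · adj X ≡ ((a * det X - b * det Y) · X) ⊞ ((mixedDet X Y * b) · Y)
adj-relation {a} {b} {ε} (mat x₁ x₂ x₃ x₄) (mat y₁ y₂ y₃ y₄) S =
  relation (a * det X - b * det Y) (mixedDet X Y) refl refl
  where
  open EntryEquations (solution⇒entries S)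
  X = mat x₁ x₂ x₃ x₄
  Y = mat y₁ y₂ y₃ y₄
  -- u and v enter as variables with their defining equations, so that solve sees them as atoms.
  relation : ∀ u v → u ≡ a * (x₁ * x₄ - x₂ * x₃) - b * (y₁ * y₄ - y₂ * y₃) →
    v ≡ x₁ * y₄ + x₄ * y₁ - x₂ * y₃ - x₃ * y₂ → ε · adj X ≡ (u · X) ⊞ ((v * b) · Y)
  relation u v hu hv = mat-cong e₁₁ e₁₂ e₂₁ e₂₂
    where
    vars = u ∷ v ∷ a ∷ b ∷ ε ∷ x₁ ∷ x₂ ∷ x₃ ∷ x₄ ∷ y₁ ∷ y₂ ∷ y₃ ∷ y₄ ∷ []
    e₁₁ : ε * x₄ ≡ u * x₁ + v * b * y₁
    e₁₁ = linear-combination (- x₄ ⊙ square₁₁ ⊕ x₃ ⊙ square₁₂ ⊕ b * y₁ ⊙ commute₁₁ ⊕ b * y₂ ⊙ commute₂₁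
                                ⊕ - x₁ ⊙ hu ⊕ - (b * y₁) ⊙ hv) (solve vars)
    e₁₂ : ε * - x₂ ≡ u * x₂ + v * b * y₂
    e₁₂ = linear-combination (x₂ ⊙ square₁₁ ⊕ - x₁ ⊙ square₁₂ ⊕ b * y₁ ⊙ commute₁₂ ⊕ b * y₂ ⊙ commute₂₂
                                ⊕ - x₂ ⊙ hu ⊕ - (b * y₂) ⊙ hv) (solve vars)
    e₂₁ : ε * - x₃ ≡ u * x₃ + v * b * y₃
    e₂₁ = linear-combination (- x₄ ⊙ square₂₁ ⊕ x₃ ⊙ square₂₂ ⊕ b * y₃ ⊙ commute₁₁ ⊕ b * y₄ ⊙ commute₂₁
                                ⊕ - x₃ ⊙ hu ⊕ - (b * y₃) ⊙ hv) (solve vars)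
    e₂₂ : ε * x₁ ≡ u * x₄ + v * b * y₄
    e₂₂ = linear-combination (x₂ ⊙ square₂₁ ⊕ - x₁ ⊙ square₂₂ ⊕ b * y₃ ⊙ commute₁₂ ⊕ b * y₄ ⊙ commute₂₂
                                ⊕ - x₄ ⊙ hu ⊕ - (b * y₄) ⊙ hv) (solve vars)

adj-relation-swap : ∀ {a b ε} (X Y : M₂) → CommutingSolution a b ε X Y →
  ε · adj Y ≡ ((mixedDet X Y * a) · X) ⊞ ((- (a * det X - b * det Y)) · Y)
adj-relation-swap {a} {b} {ε} X Y S = begin
  ε · adj Y
    ≡⟨ adj-relation Y X (swap-solution S) ⟩
  ((b * det Y - a * det X) · Y) ⊞ ((mixedDet Y X * a) · X)
    ≡⟨ ⊞-comm ((b * det Y - a * det X) · Y) ((mixedDet Y X * a) · X) ⟩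
  ((mixedDet Y X * a) · X) ⊞ ((b * det Y - a * det X) · Y)
    ≡⟨ cong₂ (λ v u → ((v * a) · X) ⊞ (u · Y))
             (mixedDet-comm Y X) (sym (⁻¹-anti-homo‿- (a * det X) (b * det Y))) ⟩
  ((mixedDet X Y * a) · X) ⊞ ((- (a * det X - b * det Y)) · Y) ∎
  where open ≡-Reasoning

-- Coordinates of M₂ that vanish on the scalar matrices; on them adj acts as negation.
data Coord : Set where
  upper lower diagonal : Coord

coord : Coord → M₂ → ℤ
coord upper X = m12 X
coord lower X = m21 X
coord diagonal X = m11 X - m22 X

coord-·-adj : ∀ c k (X : M₂) → coord c (k · adj X) ≡ k * - coord c X
coord-·-adj upper k (mat _ _ _ _) = refl
coord-·-adj lower k (mat _ _ _ _) = refl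
coord-·-adj diagonal k (mat x₁ _ _ x₄) = identity
  where
  identity : k * x₄ - k * x₁ ≡ k * - (x₁ - x₄)
  identity = solve (k ∷ x₁ ∷ x₄ ∷ [])

coord-combination : ∀ c k l (X Y : M₂) → coord c ((k · X) ⊞ (l · Y)) ≡ k * coord c X + l * coord c Y
coord-combination upper k l X Y = refl
coord-combination lower k l X Y = refl
coord-combination diagonal k l (mat x₁ _ _ x₄) (mat y₁ _ _ y₄) = identity
  where
  identity : (k * x₁ + l * y₁) - (k * x₄ + l * y₄) ≡ k * (x₁ - x₄) + l * (y₁ - y₄)
  identity = solve (k ∷ l ∷ x₁ ∷ x₄ ∷ y₁ ∷ y₄ ∷ [])

coord-relation : ∀ c k l m (X Y Z : M₂) → k · adj Z ≡ (l · X) ⊞ (m · Y) →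
  k * - coord c Z ≡ l * coord c X + m * coord c Y
coord-relation c k l m X Y Z R =
  trans (sym (coord-·-adj c k Z)) (trans (cong (coord c) R) (coord-combination c l m X Y))

scalar-or-coord : (X : M₂) → (∃[ x ] X ≡ mat x 0ℤ 0ℤ x) ⊎ (∃[ c ] coord c X ≢ 0ℤ)
scalar-or-coord (mat x₁ x₂ x₃ x₄) with x₂ ≟ 0ℤ | x₃ ≟ 0ℤ | x₁ - x₄ ≟ 0ℤ
... | no x₂≢0  | _        | _       = inj₂ (upper , x₂≢0)
... | yes _    | no x₃≢0  | _       = inj₂ (lower , x₃≢0)
... | yes _    | yes _    | no d≢0  = inj₂ (diagonal , d≢0)
... | yes refl | yes refl | yes d≡0 = inj₁ (x₁ , mat-cong refl refl refl (sym (i-j≡0⇒i≡j x₁ x₄ d≡0)))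

record CoordinateRelations (a b ε u v p q : ℤ) : Set where
  field
    onX : ε * - p ≡ u * p + v * b * q
    onY : ε * - q ≡ v * a * p + - u * q

open CoordinateRelations

coordinate-relations : ∀ {a b ε} (X Y : M₂) → CommutingSolution a b ε X Y → ∀ c →
  CoordinateRelations a b ε (a * det X - b * det Y) (mixedDet X Y) (coord c X) (coord c Y)
coordinate-relations {a} {b} {ε} X Y S c = record
  { onX = coord-relation c ε u (v * b) X Y X (adj-relation X Y S)
  ; onY = coord-relation c ε (v * a) (- u) X Y Y (adj-relation-swap X Y S)
  }
  where
  u = a * det X - b * det Y
  v = mixedDet X Y

unit-norm : ∀ {a b ε u v p q} → CoordinateRelations a b ε u v p q → ε * ε ≡ 1ℤ → p ≢ 0ℤ →
  u * u + v * v * (a * b) ≡ 1ℤ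
unit-norm {a} {b} {ε} {u} {v} {p} {q} R ε² p≢0 =
  *-cancelʳ-≡ _ _ p {{≢-nonZero p≢0}}
    (linear-combination ((ε - u) ⊙ onX R ⊕ - (v * b) ⊙ onY R ⊕ p ⊙ ε²)
                        (solve (a ∷ b ∷ ε ∷ u ∷ v ∷ p ∷ q ∷ [])))

unit≢ε : ∀ {a b ε u v p q} → CoordinateRelations a b ε u v p q → a ≢ 0ℤ → ε * ε ≡ 1ℤ → p ≢ 0ℤ →
  u ≢ ε
unit≢ε {a} {b} {ε} {u} {v} {p} {q} R a≢0 ε² p≢0 u≡ε = *-≢0 2≢0 (*-≢0 ε≢0 p≢0) 2εp≡0
  where
  2≢0 : + 2 ≢ 0ℤ
  2≢0 ()
  ε≢0 : ε ≢ 0ℤ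
  ε≢0 = unit≢0 ε²
  v≡0 : v ≡ 0ℤ
  v≡0 = *≡0⇒≡0 a≢0 (*≡0⇒≡0 p≢0 (linear-combination (-1ℤ ⊙ onY R ⊕ q ⊙ u≡ε)
                                                    (solve (a ∷ ε ∷ u ∷ v ∷ p ∷ q ∷ []))))
  2εp≡0 : + 2 * (ε * p) ≡ 0ℤ
  2εp≡0 = linear-combination (-1ℤ ⊙ onX R ⊕ - p ⊙ u≡ε ⊕ - (b * q) ⊙ v≡0)
                             (solve (b ∷ ε ∷ u ∷ v ∷ p ∷ q ∷ []))

cross-relation : ∀ {a b ε u v p q} → CoordinateRelations a b ε u v p q → v * a * p ≡ (u - ε) * q
cross-relation {a} {b} {ε} {u} {v} {p} {q} R =
  linear-combination (-1ℤ ⊙ onY R) (solve (a ∷ ε ∷ u ∷ v ∷ p ∷ q ∷ []))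

-- Uses a (u − ε)² + b (v a)² = 2 a (1 − ε u), from u² + v² a b = 1 and ε² = 1.
scaled-norm : ∀ a b ε u v P Q g x y t₂ t₃ → ε * ε ≡ 1ℤ → u * u + v * v * (a * b) ≡ 1ℤ →
  P * g ≡ u - ε → Q * g ≡ v * a →
  a * (x * x + P * t₂ * (P * t₃)) + b * (y * y + Q * t₂ * (Q * t₃)) ≡ ε * 1ℤ →
  (a * x * x + b * y * y) * (g * g) + (+ 2) * a * t₂ * t₃ * (1ℤ - ε * u) ≡ ε * (g * g)
scaled-norm a b ε u v P Q g x y t₂ t₃ ε² norm hP hQ h =
  linear-combination
    (g * g ⊙ h ⊕ - (t₂ * t₃ * a * (P * g + (u - ε))) ⊙ hP ⊕ - (t₂ * t₃ * b * (Q * g + v * a)) ⊙ hQ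
       ⊕ - (t₂ * t₃ * a) ⊙ norm ⊕ - (t₂ * t₃ * a) ⊙ ε²)
    (solve (a ∷ b ∷ ε ∷ u ∷ v ∷ P ∷ Q ∷ g ∷ x ∷ y ∷ t₂ ∷ t₃ ∷ []))

nonscalar-case : ∀ {a b ε} → a ≢ 0ℤ → ε * ε ≡ 1ℤ → (X Y : M₂) → CommutingSolution a b ε X Y →
  ∀ c → coord c X ≢ 0ℤ → CofactorPair a b ε X Y
nonscalar-case {a} {b} {ε} a≢0 ε² (mat x₁ x₂ x₃ x₄) (mat y₁ y₂ y₃ y₄) S c p≢0 =
  x₁ , t₂ , t₃ , y₁ , u , v , u≢ε , X≡ , Y≡ , norm ,
  scaled-norm a b ε u v P Q g x₁ y₁ t₂ t₃ ε² norm P*g≡U Q*g≡V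
    (EntryEquations.square₁₁ (solution⇒entries (subst₂ (CommutingSolution a b ε) X≡ Y≡ S)))
  where
  X = mat x₁ x₂ x₃ x₄
  Y = mat y₁ y₂ y₃ y₄
  u = a * det X - b * det Y
  v = mixedDet X Y
  g = gcd (v * a) (u - ε)
  P = (u - ε) // g
  Q = (v * a) // g
  R = coordinate-relations X Y S
  norm : u * u + v * v * (a * b) ≡ 1ℤ
  norm = unit-norm (R c) ε² p≢0
  u≢ε : u ≢ ε
  u≢ε = unit≢ε (R c) a≢0 ε² p≢0
  U≢0 : u - ε ≢ 0ℤ
  U≢0 e = u≢ε (i-j≡0⇒i≡j u ε e)
  P*g≡U : P * g ≡ u - ε
  P*g≡U = cofactorʳ-exact (v * a) (u - ε) U≢0
  Q*g≡V : Q * g ≡ v * a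
  Q*g≡V = cofactorˡ-exact (v * a) (u - ε) U≢0
  split₂ : ∃[ t ] (x₂ ≡ P * t × y₂ ≡ Q * t)
  split₂ = cofactor-split (v * a) U≢0 (cross-relation (R upper))
  split₃ : ∃[ t ] (x₃ ≡ P * t × y₃ ≡ Q * t)
  split₃ = cofactor-split (v * a) U≢0 (cross-relation (R lower))
  t₂ = proj₁ split₂
  t₃ = proj₁ split₃
  x₄≡ : x₄ ≡ ε * (u * x₁ + v * b * y₁)
  x₄≡ = unscale ε ε² (cong m11 (adj-relation X Y S))
  y₄≡ : y₄ ≡ ε * (v * a * x₁ - u * y₁)
  y₄≡ = trans (unscale ε ε² (cong m11 (adj-relation-swap X Y S)))
              (cong (λ w → ε * (v * a * x₁ + w)) (sym (neg-distribˡ-* u y₁)))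
  X≡ : X ≡ mat x₁ (P * t₂) (P * t₃) (ε * (u * x₁ + v * b * y₁))
  X≡ = mat-cong refl (proj₁ (proj₂ split₂)) (proj₁ (proj₂ split₃)) x₄≡
  Y≡ : Y ≡ mat y₁ (Q * t₂) (Q * t₃) (ε * (v * a * x₁ - u * y₁))
  Y≡ = mat-cong refl (proj₂ (proj₂ split₂)) (proj₂ (proj₂ split₃)) y₄≡

scalar-case : ∀ {a b ε} → b ≢ 0ℤ → (x : ℤ) (Y : M₂) → CommutingSolution a b ε (mat x 0ℤ 0ℤ x) Y →
  ScalarPair a b ε (mat x 0ℤ 0ℤ x) Y ⊎ ScalarTracelessPair a b ε (mat x 0ℤ 0ℤ x) Y
scalar-case {a} {b} {ε} b≢0 x (mat y₁ y₂ y₃ y₄) S = by-trace (y₁ + y₄ ≟ 0ℤ)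
  where
  open EntryEquations (solution⇒entries S)
  by-trace : Dec (y₁ + y₄ ≡ 0ℤ) →
    ScalarPair a b ε (mat x 0ℤ 0ℤ x) (mat y₁ y₂ y₃ y₄) ⊎ ScalarTracelessPair a b ε (mat x 0ℤ 0ℤ x) (mat y₁ y₂ y₃ y₄)
  by-trace (yes tr≡0) =
    inj₂ (x , y₂ , y₃ , y₁ , scalar-mat x , mat-cong refl refl refl y₄≡-y₁ ,
          linear-combination square₁₁ (solve (a ∷ b ∷ ε ∷ x ∷ y₁ ∷ y₂ ∷ y₃ ∷ [])))
    where
    y₄≡-y₁ : y₄ ≡ - y₁
    y₄≡-y₁ = linear-combination tr≡0 (solve (y₁ ∷ y₄ ∷ []))
  by-trace (no tr≢0) =
    inj₁ (x , y₁ , scalar-mat x , trans (mat-cong refl y₂≡0 y₃≡0 (sym y₁≡y₄)) (scalar-mat y₁) ,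
          linear-combination (square₁₁ ⊕ - (b * y₃) ⊙ y₂≡0) (solve (a ∷ b ∷ ε ∷ x ∷ y₁ ∷ y₂ ∷ y₃ ∷ [])))
    where
    b·tr≢0 : b * (y₁ + y₄) ≢ 0ℤ
    b·tr≢0 = *-≢0 b≢0 tr≢0
    y₂≡0 : y₂ ≡ 0ℤ
    y₂≡0 = *≡0⇒≡0 b·tr≢0 (linear-combination square₁₂ (solve (a ∷ b ∷ ε ∷ x ∷ y₁ ∷ y₂ ∷ y₄ ∷ [])))
    y₃≡0 : y₃ ≡ 0ℤ
    y₃≡0 = *≡0⇒≡0 b·tr≢0 (linear-combination square₂₁ (solve (a ∷ b ∷ ε ∷ x ∷ y₁ ∷ y₃ ∷ y₄ ∷ [])))
    y₁≡y₄ : y₁ ≡ y₄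
    y₁≡y₄ = i-j≡0⇒i≡j y₁ y₄ (*≡0⇒≡0 b·tr≢0 (linear-combination (square₁₁ ⊕ -1ℤ ⊙ square₂₂)
                                                                (solve (a ∷ b ∷ ε ∷ x ∷ y₁ ∷ y₂ ∷ y₃ ∷ y₄ ∷ []))))

solution⇒listed : ∀ {a b ε} → a ≢ 0ℤ → b ≢ 0ℤ → ε * ε ≡ 1ℤ → (X Y : M₂) →
  CommutingSolution a b ε X Y → Listed a b ε X Y
solution⇒listed a≢0 b≢0 ε² X Y S with scalar-or-coord X
... | inj₁ (x , refl) = Sum.map₂ inj₁ (scalar-case b≢0 x Y S)
... | inj₂ (c , p≢0) = inj₂ (inj₂ (nonscalar-case a≢0 ε² X Y S c p≢0))

scalar-quadratic : ∀ a b s r (Y : M₂) → Y ⊠ Y ≡ r · I →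
  (a · ((s · I) ⊠ (s · I))) ⊞ (b · (Y ⊠ Y)) ≡ (a * (s * s) + b * r) · I
scalar-quadratic a b s r Y Y²≡rI =
  trans (cong₂ (λ A B → (a · A) ⊞ (b · B)) (scalar-square s) Y²≡rI) (scalar-combination a b (s * s) r)

scalar-pair-solves : ∀ {a b ε} (X Y : M₂) → ScalarPair a b ε X Y → CommutingSolution a b ε X Y
scalar-pair-solves {a} {b} _ _ (t₁ , t₂ , refl , refl , e) = solution
  (trans (scalar-quadratic a b t₁ (t₂ * t₂) (t₂ · I) (scalar-square t₂))
         (cong (_· I) (trans (sym (cong₂ _+_ (*-assoc a t₁ t₁) (*-assoc b t₂ t₂))) e)))
  (scalar-commutes t₁ (t₂ · I))

scalar-traceless-pair-solves : ∀ {a b ε} (X Y : M₂) → ScalarTracelessPair a b ε X Y →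
  CommutingSolution a b ε X Y
scalar-traceless-pair-solves {a} {b} _ _ (t₁ , t₂ , t₃ , t₄ , refl , refl , e) = solution
  (trans (scalar-quadratic a b t₁ (t₄ * t₄ + t₂ * t₃) (mat t₄ t₂ t₃ (- t₄)) (traceless-square t₄ t₂ t₃))
         (cong (_· I) (trans (cong (_+ b * (t₄ * t₄ + t₂ * t₃)) (sym (*-assoc a t₁ t₁))) e)))
  (scalar-commutes t₁ (mat t₄ t₂ t₃ (- t₄)))

cofactor-pair-solves : ∀ {a b ε} u v P Q g t₁ t₂ t₃ t₄ → g ≢ 0ℤ → ε * ε ≡ 1ℤ →
  u * u + v * v * (a * b) ≡ 1ℤ → P * g ≡ u - ε → Q * g ≡ v * a →
  (a * t₁ * t₁ + b * t₄ * t₄) * (g * g) + (+ 2) * a * t₂ * t₃ * (1ℤ - ε * u) ≡ ε * (g * g) →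
  CommutingSolution a b ε (mat t₁ (P * t₂) (P * t₃) (ε * (u * t₁ + v * b * t₄)))
                          (mat t₄ (Q * t₂) (Q * t₃) (ε * (v * a * t₁ - u * t₄)))
cofactor-pair-solves {a} {b} {ε} u v P Q g t₁ t₂ t₃ t₄ g≢0 ε² norm hP hQ h = entries⇒solution (record
  { square₁₁ = ÷g² (linear-combination
      (h ⊕ t₂ * t₃ * a * (P * g + (u - ε)) ⊙ hP ⊕ t₂ * t₃ * b * (Q * g + v * a) ⊙ hQ
         ⊕ t₂ * t₃ * a ⊙ norm ⊕ t₂ * t₃ * a ⊙ ε²) (solve vars))
  ; square₁₂ = ÷g (linear-combination
      (a * t₂ * (t₁ + ε * (u * t₁ + v * b * t₄)) ⊙ hP ⊕ b * t₂ * (t₄ + ε * (v * a * t₁ - u * t₄)) ⊙ hQ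
         ⊕ t₂ * t₁ * a * ε ⊙ norm ⊕ - (t₂ * (t₁ * a * u + t₄ * a * b * v)) ⊙ ε²) (solve vars))
  ; square₂₁ = ÷g (linear-combination
      (a * t₃ * (t₁ + ε * (u * t₁ + v * b * t₄)) ⊙ hP ⊕ b * t₃ * (t₄ + ε * (v * a * t₁ - u * t₄)) ⊙ hQ
         ⊕ t₃ * t₁ * a * ε ⊙ norm ⊕ - (t₃ * (t₁ * a * u + t₄ * a * b * v)) ⊙ ε²) (solve vars))
  ; square₂₂ = ÷g² (linear-combination
      (h ⊕ t₂ * t₃ * a * (P * g + (u - ε)) ⊙ hP ⊕ t₂ * t₃ * b * (Q * g + v * a) ⊙ hQ
         ⊕ (t₂ * t₃ * a + g * g * (a * t₁ * t₁ + b * t₄ * t₄) * (ε * ε)) ⊙ norm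
         ⊕ (t₂ * t₃ * a + g * g * (a * t₁ * t₁ + b * t₄ * t₄)) ⊙ ε²) (solve vars))
  ; commute₁₁ = solve vars
  ; commute₁₂ = ÷g (linear-combination
      (t₂ * (ε * (v * a * t₁ - u * t₄) - t₄) ⊙ hP ⊕ t₂ * (t₁ - ε * (u * t₁ + v * b * t₄)) ⊙ hQ
         ⊕ - (ε * t₄ * t₂) ⊙ norm ⊕ t₂ * (u * t₄ - v * a * t₁) ⊙ ε²) (solve vars))
  ; commute₂₁ = ÷g (linear-combination
      (- (t₃ * (ε * (v * a * t₁ - u * t₄) - t₄)) ⊙ hP ⊕ - (t₃ * (t₁ - ε * (u * t₁ + v * b * t₄))) ⊙ hQ
         ⊕ ε * t₄ * t₃ ⊙ norm ⊕ - (t₃ * (u * t₄ - v * a * t₁)) ⊙ ε²) (solve vars))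
  ; commute₂₂ = solve vars
  })
  where
  vars = a ∷ b ∷ ε ∷ u ∷ v ∷ P ∷ Q ∷ g ∷ t₁ ∷ t₂ ∷ t₃ ∷ t₄ ∷ []
  ÷g : ∀ {i j} → i * g ≡ j * g → i ≡ j
  ÷g = *-cancelʳ-≡ _ _ g {{≢-nonZero g≢0}}
  ÷g² : ∀ {i j} → i * (g * g) ≡ j * (g * g) → i ≡ j
  ÷g² = *-cancelʳ-≡ _ _ (g * g) {{≢-nonZero (*-≢0 g≢0 g≢0)}}

listed⇒solution : ∀ {a b ε} → ε * ε ≡ 1ℤ → (X Y : M₂) → Listed a b ε X Y → CommutingSolution a b ε X Y
listed⇒solution _ X Y (inj₁ pair) = scalar-pair-solves X Y pair
listed⇒solution _ X Y (inj₂ (inj₁ pair)) = scalar-traceless-pair-solves X Y pair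
listed⇒solution {a} {ε = ε} ε² _ _ (inj₂ (inj₂ (t₁ , t₂ , t₃ , t₄ , u , v , u≢ε , refl , refl , norm , h))) =
  cofactor-pair-solves u v ((u - ε) // g) ((v * a) // g) g t₁ t₂ t₃ t₄ (gcd≢0 (v * a) U≢0) ε² norm
                       (cofactorʳ-exact (v * a) (u - ε) U≢0) (cofactorˡ-exact (v * a) (u - ε) U≢0) h
  where
  g = gcd (v * a) (u - ε)
  U≢0 : u - ε ≢ 0ℤ
  U≢0 e = u≢ε (i-j≡0⇒i≡j u ε e)

±1-squared : ∀ {ε : ℤ} → ε ≡ 1ℤ ⊎ ε ≡ -1ℤ → ε * ε ≡ 1ℤ
±1-squared (inj₁ refl) = refl
±1-squared (inj₂ refl) = refl

corollary4p1 : (a b ε : ℤ) → a ≢ 0ℤ → b ≢ 0ℤ → ¬ IsSquare (- (a * b)) → (ε ≡ 1ℤ ⊎ ε ≡ -1ℤ) → (X Y : M₂) →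
    (((a · (X ⊠ X)) ⊞ (b · (Y ⊠ Y)) ≡ ε · I) × (X ⊠ Y ≡ Y ⊠ X))
    ⇔
    ((∃[ t₁ ] ∃[ t₂ ] (X ≡ t₁ · I × Y ≡ t₂ · I × a * t₁ * t₁ + b * t₂ * t₂ ≡ ε))
     ⊎ (∃[ t₁ ] ∃[ t₂ ] ∃[ t₃ ] ∃[ t₄ ]
          (X ≡ t₁ · I × Y ≡ mat t₄ t₂ t₃ (- t₄)
           × a * t₁ * t₁ + b * (t₄ * t₄ + t₂ * t₃) ≡ ε))
     ⊎ (∃[ t₁ ] ∃[ t₂ ] ∃[ t₃ ] ∃[ t₄ ] ∃[ u ] ∃[ v ]
          (let g = gcd (v * a) (u - ε) in
           u ≢ ε
           × X ≡ mat t₁ (((u - ε) // g) * t₂) (((u - ε) // g) * t₃) (ε * (u * t₁ + v * b * t₄))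
           × Y ≡ mat t₄ (((v * a) // g) * t₂) (((v * a) // g) * t₃) (ε * (v * a * t₁ - u * t₄))
           × u * u + v * v * (a * b) ≡ 1ℤ
           × (a * t₁ * t₁ + b * t₄ * t₄) * (g * g) + (+ 2) * a * t₂ * t₃ * (1ℤ - ε * u) ≡ ε * (g * g))))
corollary4p1 a b ε a≢0 b≢0 _ ε≡±1 X Y = mk⇔
  (λ (H , C) → solution⇒listed a≢0 b≢0 ε² X Y (solution H C))
  (λ listed → < equation , commute > (listed⇒solution ε² X Y listed))
  where
  ε² = ±1-squared ε≡±1
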